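{- Let $H$ be a bipartite graph with bipartition $\{X, Y\}$ whose vertex set is partitioned into sets $U_1, \dots, U_k$. Suppose that $M$ is a matching in $H$ that balances $U_i$ for every $i \in [k]$. Then $M$ contains a matching that has at most $(\mathrm{imb}(U_1) + \dots + \mathrm{imb}(U_k))k/2$ edges and balances $U_i$ for every $i \in [k]$.
   Context: For $U \subset V(H)$, the imbalance is $\mathrm{imb}(U) = \big||U \cap X| - |U \cap Y|\big|$. A subgraph $F \subset H$ (e.g. a matching) balances $U$ if $|(U \cap X) \setminus V(F)| = |(U \cap Y) \setminus V(F)|$. -}

module Defs where

open import Data.Bool using (Bool; true; false)
import Data.Bool.Properties as BoolP
open import Data.Nat using (ℕ; _+_; _*_; ∣_-_∣)
open import Data.Fin using (Fin)
import Data.Fin.Properties as FinP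
open import Data.List using (List; []; _∷_; _++_; length; filter; allFin; map)
open import Data.Nat.ListAction using (sum)
open import Data.List.Membership.Propositional using (_∈_)
import Data.List.Membership.DecPropositional as DecMem
open import Data.List.Relation.Unary.All using (All)
open import Data.List.Relation.Unary.Unique.Propositional using (Unique)
open import Data.Product using (_×_; _,_)
open import Relation.Binary.PropositionalEquality using (_≡_; _≢_)
open import Relation.Nullary using (¬_)
open import Relation.Nullary.Decidable using (_×-dec_; ¬?)

-- The bipartition {X, Y} is given by
-- side : Fin n → Bool, with X = {v | side v ≡ true}, Y = {v | side v ≡ false}.
-- The partition U₁,…,U_k of V(H) is given by part : Fin n → Fin k,
-- with U_i = {v | part v ≡ i}.

Edge : ℕ → Set
Edge n = Fin n × Fin n

IsBipartite : ∀ {n} → (side : Fin n → Bool) → (E : Fin n → Fin n → Set) → Set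
IsBipartite side E = ∀ u v → E u v → side u ≢ side v

vertices : ∀ {n} → List (Edge n) → List (Fin n)
vertices [] = []
vertices ((u , v) ∷ F) = u ∷ v ∷ vertices F

-- M is a matching in H: every edge of M is an edge of H, and no vertex is
-- covered twice (edges pairwise disjoint, no repeated edges, no loops).
IsMatching : ∀ {n} → (E : Fin n → Fin n → Set) → List (Edge n) → Set
IsMatching E M = All (λ e → E (Data.Product.proj₁ e) (Data.Product.proj₂ e)) M
               × Unique (vertices M)

countOut : ∀ {n k} → (side : Fin n → Bool) → (part : Fin n → Fin k)
         → Fin k → Bool → List (Edge n) → ℕ
countOut side part i b F =
  length (filter (λ v → ((part v FinP.≟ i) ×-dec (side v BoolP.≟ b)) ×-dec ¬? (DecMem._∈?_ (FinP._≟_ {_}) v (vertices F)))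
                 (allFin _))

count : ∀ {n k} → (side : Fin n → Bool) → (part : Fin n → Fin k) → Fin k → Bool → ℕ
count side part i b =
  length (filter (λ v → (part v FinP.≟ i) ×-dec (side v BoolP.≟ b)) (allFin _))

imb : ∀ {n k} → (side : Fin n → Bool) → (part : Fin n → Fin k) → Fin k → ℕ
imb side part i = ∣ count side part i true - count side part i false ∣

Balances : ∀ {n k} → (side : Fin n → Bool) → (part : Fin n → Fin k)
         → List (Edge n) → Fin k → Set
Balances side part F i = countOut side part i true F ≡ countOut side part i false F

totalImb : ∀ {n k} → (side : Fin n → Bool) → (part : Fin n → Fin k) → ℕ
totalImb {k = k} side part = sum (map (imb side part) (allFin k))

-- Orient every edge of M from its X-end to its Y-end and contract each U_i to
-- a point i of [k].  M becomes a multidigraph on [k] whose net out-flow at i is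
-- |U_i ∩ X ∩ V(M)| − |U_i ∩ Y ∩ V(M)| = ±imb(U_i), as M balances U_i; and a
-- sub-matching balances every U_i exactly when it has the same net flows.
-- Deleting a directed cycle keeps all net flows, so M contains an acyclic F
-- with the net flows of M.  Rank the points of F topologically by
-- r : [k] → {0,…,k−1} and weigh i by w(i) = k − 2 r(i): each arc of F loses at
-- least 2 in weight, while |w| ≤ k, hence
--   2|F| ≤ Σ_i w(i) · flow(i) ≤ k Σ_i imb(U_i).
-- F is built arc by arc together with a potential increasing along its arcs:
-- an arc whose tail is reachable from its head closes a cycle, which is then
-- cancelled; otherwise everything reachable from its head is lifted above its
-- tail.

{-# OPTIONS --safe #-}
module Submission where

open import Defs
open import Data.Bool as Bool using (Bool; true; false; T; _∧_; _∨_; not; if_then_else_)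
open import Data.Bool.ListAction using (any)
import Data.Bool.Properties as BoolP
open import Data.Empty using (⊥-elim)
open import Data.Fin as Fin using (Fin; zero; suc)
open import Data.Integer as ℤ using (ℤ; +_; 0ℤ; _-_; _⊖_)
import Data.Integer.Properties as ℤP
open import Data.Integer.Tactic.RingSolver using (solve-∀)
open import Data.List using (List; []; _∷_; length; filter; allFin; tabulate)
open import Data.List.Membership.Propositional using (_∈_; find; lose)
open import Data.List.Membership.Propositional.Properties using (∈-allFin)
import Data.List.Membership.DecPropositional as DecMembership
open import Data.List.Properties using (filter-notAll; length-tabulate; map-tabulate; tabulate-cong)
open import Data.List.Relation.Binary.Sublist.Propositional
  using (_⊆_; []; _∷_; _∷ʳ_; minimum; ⊆-refl; ⊆-trans)
open import Data.List.Relation.Binary.Sublist.Propositional.Properties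
  using (All-resp-⊆; filter⁺; length-mono-≤)
open import Data.List.Relation.Unary.All as All using (All; []; _∷_)
open import Data.List.Relation.Unary.All.Properties using (All¬⇒¬Any)
open import Data.List.Relation.Unary.AllPairs using ([]; _∷_)
open import Data.List.Relation.Unary.Any using (here; there)
open import Data.List.Relation.Unary.Any.Properties using (any⁺; any⁻)
open import Data.List.Relation.Unary.Unique.Propositional using (Unique)
open import Data.List.Relation.Unary.Unique.Propositional.Properties using (allFin⁺)
open import Data.Nat as ℕ using (ℕ; zero; suc; _+_; _*_; _∸_; _≤_; _<_; z≤n; s≤s)
open import Data.Nat.ListAction using (sum)
import Data.Nat.Properties as ℕP
open import Data.Product using (Σ; ∃-syntax; _×_; _,_; proj₁; proj₂)
open import Data.Sum using (_⊎_; inj₁; inj₂; [_,_])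
open import Function using (_∘_; id; _⇔_; mk⇔; Equivalence)
open import Relation.Binary.Definitions using (DecidableEquality)
open import Relation.Binary.PropositionalEquality
  using (_≡_; _≢_; refl; sym; trans; cong; cong₂; subst; module ≡-Reasoning)
open import Relation.Nullary using (¬_; yes; no; does)
open import Relation.Nullary.Decidable using (⌊_⌋; dec-true; dec-false; toWitness; fromWitness)
open import Relation.Unary using (Decidable)

open import Algebra.Properties.CommutativeSemigroup ℤP.+-commutativeSemigroup using (x∙yz≈y∙xz)
open import Algebra.Properties.Monoid.Sum ℤP.+-0-monoid using () renaming (sum to ∑)

infix 7 _·_

_·_ : ∀ {m} → (Fin m → ℤ) → (Fin m → ℤ) → ℤ
w · d = ∑ (λ i → w i ℤ.* d i)

𝟙 : Bool → ℕ
𝟙 b = if b then 1 else 0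

δ : ∀ {m} → Fin m → Fin m → ℤ
δ a i = + 𝟙 (does (a Fin.≟ i))

·-zeroʳ : ∀ {m} (w : Fin m → ℤ) → w · (λ _ → 0ℤ) ≡ 0ℤ
·-zeroʳ {zero}  w = refl
·-zeroʳ {suc m} w = cong₂ ℤ._+_ (ℤP.*-zeroʳ (w zero)) (·-zeroʳ (w ∘ suc))

·-δ : ∀ {m} (w : Fin m → ℤ) a → w · δ a ≡ w a
·-δ {suc m} w zero =
  trans (cong₂ ℤ._+_ (ℤP.*-identityʳ (w zero)) (·-zeroʳ (w ∘ suc))) (ℤP.+-identityʳ (w zero))
·-δ {suc m} w (suc a) =
  trans (cong₂ ℤ._+_ (ℤP.*-zeroʳ (w zero)) (·-δ (w ∘ suc) a)) (ℤP.+-identityˡ (w (suc a)))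

·-linear : ∀ {m} (w p q r : Fin m → ℤ) →
           w · (λ i → p i - q i ℤ.+ r i) ≡ w · p - w · q ℤ.+ w · r
·-linear {zero}  w p q r = refl
·-linear {suc m} w p q r
  rewrite ·-linear (w ∘ suc) (p ∘ suc) (q ∘ suc) (r ∘ suc) =
  distrib (w zero) (p zero) (q zero) (r zero) ((w ∘ suc) · (p ∘ suc)) ((w ∘ suc) · (q ∘ suc)) ((w ∘ suc) · (r ∘ suc))
  where
  distrib : ∀ w p q r P Q R → w ℤ.* (p - q ℤ.+ r) ℤ.+ (P - Q ℤ.+ R)
                            ≡ (w ℤ.* p ℤ.+ P) - (w ℤ.* q ℤ.+ Q) ℤ.+ (w ℤ.* r ℤ.+ R)
  distrib = solve-∀

i≤+∣i∣ : ∀ i → i ℤ.≤ + ℤ.∣ i ∣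
i≤+∣i∣ (+ n)      = ℤP.≤-refl
i≤+∣i∣ ℤ.-[1+ n ] = ℤ.-≤+

∣m⊖n∣≡∣m-n∣ : ∀ m n → ℤ.∣ m ⊖ n ∣ ≡ ℕ.∣ m - n ∣
∣m⊖n∣≡∣m-n∣ zero    zero    = refl
∣m⊖n∣≡∣m-n∣ zero    (suc n) = refl
∣m⊖n∣≡∣m-n∣ (suc m) zero    = refl
∣m⊖n∣≡∣m-n∣ (suc m) (suc n) =
  trans (cong ℤ.∣_∣ (ℤP.[1+m]⊖[1+n]≡m⊖n m n)) (∣m⊖n∣≡∣m-n∣ m n)

·-≤ : ∀ {m} (w d : Fin m → ℤ) {c} → (∀ i → ℤ.∣ w i ∣ ≤ c) →
      w · d ℤ.≤ + (c * sum (tabulate (ℤ.∣_∣ ∘ d)))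
·-≤ {zero}  w d ∣w∣≤c = ℤ.+≤+ z≤n
·-≤ {suc m} w d {c} ∣w∣≤c =
  subst (w · d ℤ.≤_) (cong +_ (sym (ℕP.*-distribˡ-+ c _ _)))
    (ℤP.+-mono-≤ head (·-≤ (w ∘ suc) (d ∘ suc) (∣w∣≤c ∘ suc)))
  where
  head : w zero ℤ.* d zero ℤ.≤ + (c * ℤ.∣ d zero ∣)
  head = ℤP.≤-trans (i≤+∣i∣ _) (ℤ.+≤+ (subst (_≤ c * ℤ.∣ d zero ∣)
           (sym (ℤP.∣i*j∣≡∣i∣*∣j∣ (w zero) (d zero))) (ℕP.*-monoˡ-≤ ℤ.∣ d zero ∣ (∣w∣≤c zero))))

countᵇ : ∀ {A : Set} → (A → Bool) → List A → ℕ
countᵇ p []       = 0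
countᵇ p (x ∷ xs) = 𝟙 (p x) + countᵇ p xs

length-filter≡countᵇ : ∀ {A : Set} {P : A → Set} (P? : Decidable P) xs →
                       length (filter P? xs) ≡ countᵇ (does ∘ P?) xs
length-filter≡countᵇ P? []       = refl
length-filter≡countᵇ P? (x ∷ xs) with does (P? x)
... | true  = cong suc (length-filter≡countᵇ P? xs)
... | false = length-filter≡countᵇ P? xs

countᵇ-cong : ∀ {A : Set} {p q : A → Bool} {xs} → All (λ x → p x ≡ q x) xs → countᵇ p xs ≡ countᵇ q xs
countᵇ-cong []         = refl
countᵇ-cong (eq ∷ eqs) = cong₂ _+_ (cong 𝟙 eq) (countᵇ-cong eqs)

module Counting {A : Set} (_≟_ : DecidableEquality A) where

  open DecMembership _≟_ public using (_∈?_)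

  ∧-not-≟-≢ : ∀ (p : A → Bool) {x w} → x ≢ w → p x ∧ not (does (x ≟ w)) ≡ p x
  ∧-not-≟-≢ p {x} {w} x≢w rewrite dec-false (x ≟ w) x≢w = BoolP.∧-identityʳ (p x)

  countᵇ-remove : ∀ (p : A → Bool) {xs} → Unique xs → ∀ {w} → w ∈ xs →
                  countᵇ p xs ≡ countᵇ (λ x → p x ∧ not (does (x ≟ w))) xs + 𝟙 (p w)
  countᵇ-remove p {w ∷ xs} (w∉xs ∷ _) (here refl)
    rewrite dec-true (w ≟ w) refl
          | countᵇ-cong {p = p} {xs = xs} (All.map (λ w≢x → sym (∧-not-≟-≢ p (w≢x ∘ sym))) w∉xs)
    with p w
  ... | true  = ℕP.+-comm 1 _
  ... | false = sym (ℕP.+-identityʳ _)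
  countᵇ-remove p {y ∷ xs} (y∉xs ∷ xs!) (there w∈xs)
    rewrite dec-false (y ≟ _) (All.lookup y∉xs w∈xs) | BoolP.∧-identityʳ (p y) | countᵇ-remove p xs! w∈xs
    = sym (ℕP.+-assoc (𝟙 (p y)) _ _)

  countᵇ-outside : ∀ (p : A → Bool) {us} → Unique us → (∀ v → v ∈ us) → ∀ vs → Unique vs →
                   countᵇ (λ v → p v ∧ not (does (v ∈? vs))) us + countᵇ p vs ≡ countᵇ p us
  countᵇ-outside p {us} us! complete [] [] =
    trans (ℕP.+-identityʳ _) (countᵇ-cong {xs = us} (All.tabulate (λ {v} _ → BoolP.∧-identityʳ (p v))))
  countᵇ-outside p {us} us! complete (w ∷ ws) (w∉ws ∷ ws!) = begin
    countᵇ (λ v → p v ∧ not (does (v ≟ w) ∨ does (v ∈? ws))) us + (𝟙 (p w) + countᵇ p ws)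
      ≡⟨ cong (_+ (𝟙 (p w) + countᵇ p ws)) (countᵇ-cong {xs = us} (All.tabulate (λ {v} _ → ∧-not-∨ (p v) _ _))) ⟩
    off-w + (𝟙 (p w) + countᵇ p ws)     ≡⟨ ℕP.+-assoc off-w (𝟙 (p w)) (countᵇ p ws) ⟨
    off-w + 𝟙 (p w) + countᵇ p ws       ≡⟨ cong (λ t → off-w + 𝟙 t + countᵇ p ws) q-w ⟨
    off-w + 𝟙 (q w) + countᵇ p ws       ≡⟨ cong (_+ countᵇ p ws) (countᵇ-remove q us! (complete w)) ⟨
    countᵇ q us + countᵇ p ws           ≡⟨ countᵇ-outside p us! complete ws ws! ⟩
    countᵇ p us                         ∎
    where
    open ≡-Reasoning
    q : A → Bool
    q v = p v ∧ not (does (v ∈? ws))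
    off-w : ℕ
    off-w = countᵇ (λ v → q v ∧ not (does (v ≟ w))) us
    q-w : q w ≡ p w
    q-w rewrite dec-false (w ∈? ws) (All¬⇒¬Any w∉ws) = BoolP.∧-identityʳ (p w)
    ∧-not-∨ : ∀ a b c → a ∧ not (b ∨ c) ≡ (a ∧ not c) ∧ not b
    ∧-not-∨ true  true  c = sym (BoolP.∧-zeroʳ (not c))
    ∧-not-∨ true  false c = sym (BoolP.∧-identityʳ (not c))
    ∧-not-∨ false b     c = refl

Unique-resp-⊆ : ∀ {A : Set} {xs ys : List A} → xs ⊆ ys → Unique ys → Unique xs
Unique-resp-⊆ []         []          = []
Unique-resp-⊆ (y ∷ʳ xs⊆ys) (_ ∷ ys!)    = Unique-resp-⊆ xs⊆ys ys!
Unique-resp-⊆ (refl ∷ xs⊆ys) (y∉ys ∷ ys!) = All-resp-⊆ xs⊆ys y∉ys ∷ Unique-resp-⊆ xs⊆ys ys!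

vertices-⊆ : ∀ {n} {F M : List (Edge n)} → F ⊆ M → vertices F ⊆ vertices M
vertices-⊆ []                         = []
vertices-⊆ ((u , v) ∷ʳ F⊆M)           = u ∷ʳ v ∷ʳ vertices-⊆ F⊆M
vertices-⊆ {F = (u , v) ∷ _} (refl ∷ F⊆M) = refl ∷ refl ∷ vertices-⊆ F⊆M

length-filter-< : ∀ {A : Set} {P Q : A → Set} (P? : Decidable P) (Q? : Decidable Q) → (∀ {x} → P x → Q x) →
                  ∀ {x xs} → x ∈ xs → Q x → ¬ P x → length (filter P? xs) < length (filter Q? xs)
length-filter-< P? Q? P⇒Q {xs = y ∷ xs} x∈xs Qx ¬Px with P? y | Q? y | x∈xs
... | yes Py | _      | here refl = ⊥-elim (¬Px Py)
... | no  _  | yes _  | here refl = s≤s (length-mono-≤ (filter⁺ P? Q? (λ { refl → P⇒Q }) (⊆-refl {x = xs})))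
... | no  _  | no ¬Qy | here refl = ⊥-elim (¬Qy Qx)
... | yes Py | yes _  | there x∈ = s≤s (length-filter-< P? Q? P⇒Q x∈ Qx ¬Px)
... | yes Py | no ¬Qy | there _  = ⊥-elim (¬Qy (P⇒Q Py))
... | no  _  | yes _  | there x∈ = ℕP.m≤n⇒m≤1+n (length-filter-< P? Q? P⇒Q x∈ Qx ¬Px)
... | no  _  | no _   | there x∈ = length-filter-< P? Q? P⇒Q x∈ Qx ¬Px

rank : ∀ {k} → (Fin k → ℕ) → Fin k → ℕ
rank pot v = length (filter (λ u → pot u ℕ.<? pot v) (allFin _))

rank<k : ∀ {k} (pot : Fin k → ℕ) v → rank pot v < k
rank<k {k} pot v = subst (rank pot v <_) (length-tabulate id)
  (filter-notAll (λ u → pot u ℕ.<? pot v) (allFin k) (lose (∈-allFin v) (ℕP.<-irrefl refl)))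

rank-mono : ∀ {k} (pot : Fin k → ℕ) {u v} → pot u < pot v → rank pot u < rank pot v
rank-mono pot {u} {v} u<v = length-filter-< (λ z → pot z ℕ.<? pot u) (λ z → pot z ℕ.<? pot v)
  (λ z<u → ℕP.<-trans z<u u<v) (∈-allFin u) u<v (ℕP.<-irrefl refl)

-- Net flow of a multidigraph on Fin k

module ArcFlow (k : ℕ) {A : Set} (ends : A → Fin k × Fin k) where

  src tgt : A → Fin k
  src = proj₁ ∘ ends
  tgt = proj₂ ∘ ends

  flow : A → Fin k → ℤ
  flow x i = δ (src x) i - δ (tgt x) i

  netFlow : List A → Fin k → ℤ
  netFlow []      i = 0ℤ
  netFlow (x ∷ F) i = flow x i ℤ.+ netFlow F i

  ·-netFlow-∷ : ∀ w x F → w · netFlow (x ∷ F) ≡ w (src x) - w (tgt x) ℤ.+ w · netFlow F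
  ·-netFlow-∷ w x F
    rewrite ·-linear w (δ (src x)) (δ (tgt x)) (netFlow F) | ·-δ w (src x) | ·-δ w (tgt x) = refl

  netFlow-complement : ∀ {P F} → P ⊆ F →
                       ∃[ Q ] Q ⊆ F × (∀ i → netFlow F i ≡ netFlow P i ℤ.+ netFlow Q i)
  netFlow-complement [] = [] , [] , λ i → refl
  netFlow-complement {P} (x ∷ʳ P⊆F) with netFlow-complement P⊆F
  ... | Q , Q⊆F , eq = x ∷ Q , refl ∷ Q⊆F ,
        λ i → trans (cong (λ t → flow x i ℤ.+ t) (eq i)) (x∙yz≈y∙xz (flow x i) (netFlow P i) (netFlow Q i))
  netFlow-complement (refl ∷ P⊆F) with netFlow-complement P⊆F
  ... | Q , Q⊆F , eq = Q , _ ∷ʳ Q⊆F ,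
        λ i → trans (cong (λ t → flow _ i ℤ.+ t) (eq i)) (sym (ℤP.+-assoc (flow _ i) _ _))

  -- ¬ R x rules out that the occurrence of x in F is already taken by P.
  netFlow-insert : ∀ {R : A → Set} {P F x} → P ⊆ F → x ∈ F → All R P → ¬ R x →
                   ∃[ P′ ] P′ ⊆ F × (∀ i → netFlow P′ i ≡ netFlow P i ℤ.+ flow x i)
                          × All (λ y → R y ⊎ y ≡ x) P′
  netFlow-insert {P = P} (x ∷ʳ P⊆F) (here refl) RP ¬Rx =
    x ∷ P , refl ∷ P⊆F , (λ i → ℤP.+-comm (flow x i) (netFlow P i)) , inj₂ refl ∷ All.map inj₁ RP
  netFlow-insert (refl ∷ P⊆F) (here refl) (Rx ∷ _) ¬Rx = ⊥-elim (¬Rx Rx)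
  netFlow-insert (y ∷ʳ P⊆F) (there x∈F) RP ¬Rx with netFlow-insert P⊆F x∈F RP ¬Rx
  ... | P′ , P′⊆F , eq , RP′ = P′ , y ∷ʳ P′⊆F , eq , RP′
  netFlow-insert (refl ∷ P⊆F) (there x∈F) (Ry ∷ RP) ¬Rx with netFlow-insert P⊆F x∈F RP ¬Rx
  ... | P′ , P′⊆F , eq , RP′ = _ ∷ P′ , refl ∷ P′⊆F ,
        (λ i → trans (cong (λ t → flow _ i ℤ.+ t) (eq i)) (sym (ℤP.+-assoc (flow _ i) _ _))) , inj₁ Ry ∷ RP′

  Ascending : (Fin k → ℕ) → A → Set
  Ascending pot x = pot (src x) < pot (tgt x)

  module Reachability (F : List A) (b : Fin k) (pot : Fin k → ℕ) (asc : All (Ascending pot) F) where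

    -- A path from b to v along ascending arcs has at most pot v arcs, so
    -- reachableWithin (pot v) v decides whether v is reachable from b.
    reachableWithin : ℕ → Fin k → Bool
    reachableWithin zero    v = ⌊ v Fin.≟ b ⌋
    reachableWithin (suc n) v =
      ⌊ v Fin.≟ b ⌋ ∨ any (λ y → ⌊ tgt y Fin.≟ v ⌋ ∧ reachableWithin n (src y)) F

    reachableWithin-base : ∀ n → T (reachableWithin n b)
    reachableWithin-base zero    = fromWitness {a? = b Fin.≟ b} refl
    reachableWithin-base (suc n) = Equivalence.from BoolP.T-∨ (inj₁ (fromWitness {a? = b Fin.≟ b} refl))

    reachableWithin-step : ∀ n {x} → x ∈ F → T (reachableWithin n (src x)) → T (reachableWithin (suc n) (tgt x))
    reachableWithin-step n {x} x∈F t = Equivalence.from BoolP.T-∨ (inj₂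
      (any⁺ _ (lose x∈F (Equivalence.from BoolP.T-∧ (fromWitness {a? = tgt x Fin.≟ tgt x} refl , t)))))

    reachableWithin-suc⁻ : ∀ n {v} → T (reachableWithin (suc n) v) →
                           v ≡ b ⊎ ∃[ y ] y ∈ F × tgt y ≡ v × T (reachableWithin n (src y))
    reachableWithin-suc⁻ n {v} t with Equivalence.to BoolP.T-∨ t
    ... | inj₁ v≡b = inj₁ (toWitness {a? = v Fin.≟ b} v≡b)
    ... | inj₂ arc with find (any⁻ _ F arc)
    ...   | y , y∈F , into with Equivalence.to BoolP.T-∧ into
    ...     | y→v , t′ = inj₂ (y , y∈F , toWitness {a? = tgt y Fin.≟ v} y→v , t′)

    reachableWithin-suc : ∀ n v → T (reachableWithin n v) → T (reachableWithin (suc n) v)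
    reachableWithin-suc zero    v t = Equivalence.from BoolP.T-∨ (inj₁ t)
    reachableWithin-suc (suc n) v t with reachableWithin-suc⁻ n t
    ... | inj₁ refl                  = reachableWithin-base (suc (suc n))
    ... | inj₂ (y , y∈F , refl , t′) = reachableWithin-step (suc n) y∈F (reachableWithin-suc n (src y) t′)

    reachableWithin-+ : ∀ d {n v} → T (reachableWithin n v) → T (reachableWithin (d + n) v)
    reachableWithin-+ zero    t = t
    reachableWithin-+ (suc d) {n} {v} t = reachableWithin-suc (d + n) v (reachableWithin-+ d t)

    reachable : Fin k → Bool
    reachable v = reachableWithin (pot v) v

    reachable-base : T (reachable b)
    reachable-base = reachableWithin-base (pot b)

    reachable-closed : ∀ {x} → x ∈ F → T (reachable (src x)) → T (reachable (tgt x))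
    reachable-closed {x} x∈F t =
      subst (λ n → T (reachableWithin n (tgt x))) (ℕP.m∸n+n≡m (All.lookup asc x∈F))
        (reachableWithin-+ (pot (tgt x) ∸ suc (pot (src x))) (reachableWithin-step (pot (src x)) x∈F t))

    PathTo : Fin k → List A → Set
    PathTo v P = P ⊆ F × (∀ i → netFlow P i ≡ δ b i - δ v i) × All (λ y → pot (tgt y) ≤ pot v) P

    emptyPath : PathTo b []
    emptyPath = minimum F , (λ i → sym (ℤP.+-inverseʳ (δ b i))) , []

    path : ∀ n v → T (reachableWithin n v) → ∃[ P ] PathTo v P
    path zero v t with toWitness {a? = v Fin.≟ b} t
    ... | refl = [] , emptyPath
    path (suc n) v t with reachableWithin-suc⁻ n t
    ... | inj₁ refl = [] , emptyPath
    ... | inj₂ (y , y∈F , refl , t′) with path n (src y) t′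
    ...   | P , P⊆F , eq , below
      with netFlow-insert P⊆F y∈F (All.map (λ le → ℕP.≤-<-trans le (All.lookup asc y∈F)) below) (ℕP.<-irrefl refl)
    ...     | P′ , P′⊆F , eq′ , below′ =
      P′ , P′⊆F ,
      (λ i → trans (eq′ i) (trans (cong (λ t → t ℤ.+ flow y i) (eq i)) (telescope (δ b i) (δ (src y) i) (δ (tgt y) i)))) ,
      All.map [ ℕP.<⇒≤ , (λ { refl → ℕP.≤-refl }) ] below′
      where
      telescope : ∀ p q r → (p - q) ℤ.+ (q - r) ≡ p - r
      telescope = solve-∀

  record AcyclicPart (M : List A) : Set where
    field
      arcs      : List A
      arcs⊆M    : arcs ⊆ M
      netFlow≗  : ∀ i → netFlow arcs i ≡ netFlow M i
      potential : Fin k → ℕ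
      ascending : All (Ascending potential) arcs

  module Extend (x : A) {M : List A} (part : AcyclicPart M) where
    open AcyclicPart part
    open Reachability arcs (tgt x) potential ascending

    closesCycle : Bool
    closesCycle = reachable (src x)

    cancelCycle : T closesCycle → AcyclicPart (x ∷ M)
    cancelCycle t with path (potential (src x)) (src x) t
    ... | P , P⊆arcs , eqP , _ with netFlow-complement P⊆arcs
    ...   | Q , Q⊆arcs , eqQ = record
      { arcs      = Q
      ; arcs⊆M    = x ∷ʳ ⊆-trans Q⊆arcs arcs⊆M
      ; netFlow≗  = λ i → begin
          netFlow Q i
            ≡⟨ shuffle (flow x i) (netFlow Q i) ⟩
          flow x i ℤ.+ (ℤ.- flow x i ℤ.+ netFlow Q i)
            ≡⟨ cong (λ t → flow x i ℤ.+ (t ℤ.+ netFlow Q i)) (reverse i) ⟩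
          flow x i ℤ.+ (netFlow P i ℤ.+ netFlow Q i)
            ≡⟨ cong (λ t → flow x i ℤ.+ t) (trans (sym (eqQ i)) (netFlow≗ i)) ⟩
          flow x i ℤ.+ netFlow M i ∎
      ; potential = potential
      ; ascending = All-resp-⊆ Q⊆arcs ascending
      }
      where
      open ≡-Reasoning
      shuffle : ∀ f q → q ≡ f ℤ.+ (ℤ.- f ℤ.+ q)
      shuffle = solve-∀
      negate : ∀ s t → ℤ.- (s - t) ≡ t - s
      negate = solve-∀
      reverse : ∀ i → ℤ.- flow x i ≡ netFlow P i
      reverse i = trans (negate (δ (src x) i) (δ (tgt x) i)) (sym (eqP i))

    liftReachable : closesCycle ≡ false → AcyclicPart (x ∷ M)
    liftReachable unreached = record
      { arcs      = x ∷ arcs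
      ; arcs⊆M    = refl ∷ arcs⊆M
      ; netFlow≗  = λ i → cong (λ t → flow x i ℤ.+ t) (netFlow≗ i)
      ; potential = lifted
      ; ascending = x↑ ∷ All.tabulate y↑
      }
      where
      lift : ℕ
      lift = suc (potential (src x))
      lifted : Fin k → ℕ
      lifted v = potential v + (if reachable v then lift else 0)
      x↑ : Ascending lifted x
      x↑ rewrite unreached | Equivalence.to BoolP.T-≡ reachable-base | ℕP.+-identityʳ (potential (src x)) =
        ℕP.m≤n+m lift (potential (tgt x))
      y↑ : ∀ {y} → y ∈ arcs → Ascending lifted y
      y↑ {y} y∈arcs with reachable (src y) in r
      ... | true rewrite Equivalence.to BoolP.T-≡ (reachable-closed y∈arcs (Equivalence.from BoolP.T-≡ r)) =
        ℕP.+-monoˡ-< lift (All.lookup ascending y∈arcs)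
      ... | false = ℕP.<-≤-trans
        (subst (_< potential (tgt y)) (sym (ℕP.+-identityʳ _)) (All.lookup ascending y∈arcs)) (ℕP.m≤m+n _ _)

  extend : ∀ x {M} → AcyclicPart M → AcyclicPart (x ∷ M)
  extend x part with Extend.closesCycle x part in r
  ... | true  = Extend.cancelCycle x part (Equivalence.from BoolP.T-≡ r)
  ... | false = Extend.liftReachable x part r

  acyclicPart : ∀ M → AcyclicPart M
  acyclicPart []      = record
    { arcs = [] ; arcs⊆M = [] ; netFlow≗ = λ i → refl ; potential = λ _ → 0 ; ascending = [] }
  acyclicPart (x ∷ M) = extend x (acyclicPart M)

  module Weights (r : Fin k → ℕ) (r<k : ∀ i → r i < k) where

    weight : Fin k → ℤ
    weight i = + k - + (2 * r i)

    private
      [K-a]-[K-b]≡b-a : ∀ K a b → (K - a) - (K - b) ≡ b - a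
      [K-a]-[K-b]≡b-a = solve-∀

    weight-drop : ∀ {x} → Ascending r x → + 2 ℤ.≤ weight (src x) - weight (tgt x)
    weight-drop {x} x↑
      rewrite [K-a]-[K-b]≡b-a (+ k) (+ (2 * r (src x))) (+ (2 * r (tgt x)))
            | ℤP.m-n≡m⊖n (2 * r (tgt x)) (2 * r (src x))
            | ℤP.⊖-≥ (ℕP.*-monoʳ-≤ 2 (ℕP.<⇒≤ x↑))
      = ℤ.+≤+ (ℕP.m+n≤o⇒m≤o∸n 2
          (subst (_≤ 2 * r (tgt x)) (ℕP.*-suc 2 (r (src x))) (ℕP.*-monoʳ-≤ 2 x↑)))

    ∣weight∣≤k : ∀ i → ℤ.∣ weight i ∣ ≤ k
    ∣weight∣≤k i rewrite ℤP.m-n≡m⊖n k (2 * r i) with 2 * r i ℕP.≤? k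
    ... | yes 2r≤k rewrite ℤP.⊖-≥ 2r≤k = ℕP.m∸n≤m k (2 * r i)
    ... | no  2r≰k rewrite ℤP.∣⊖∣-≰ 2r≰k =
      ℕP.≤-trans (ℕP.∸-monoˡ-≤ k (ℕP.*-monoʳ-≤ 2 (ℕP.<⇒≤ (r<k i))))
                 (ℕP.≤-reflexive (trans (ℕP.m+n∸m≡n k (k + 0)) (ℕP.+-identityʳ k)))

    weight·netFlow≥ : ∀ F → All (Ascending r) F → + (2 * length F) ℤ.≤ weight · netFlow F
    weight·netFlow≥ []      []         = ℤP.≤-reflexive (sym (·-zeroʳ weight))
    weight·netFlow≥ (x ∷ F) (x↑ ∷ F↑) rewrite ·-netFlow-∷ weight x F | ℕP.*-suc 2 (length F) =
      ℤP.+-mono-≤ (weight-drop x↑) (weight·netFlow≥ F F↑)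

  acyclic-length-bound : ∀ F (pot : Fin k → ℕ) → All (Ascending pot) F →
                         2 * length F ≤ k * sum (tabulate (ℤ.∣_∣ ∘ netFlow F))
  acyclic-length-bound F pot F↑ =
    ℤP.drop‿+≤+ (ℤP.≤-trans (weight·netFlow≥ F (All.map (rank-mono pot) F↑))
                            (·-≤ weight (netFlow F) ∣weight∣≤k))
    where open Weights (rank pot) (rank<k pot)

-- A bipartite matching seen as a multidigraph on the parts

module Orientation {n k : ℕ} (side : Fin n → Bool) (part : Fin n → Fin k) where

  ends : Edge n → Fin k × Fin k
  ends (u , v) = if side u then (part u , part v) else (part v , part u)

  open ArcFlow k ends public

  inPart : Fin k → Bool → Fin n → Bool
  inPart i b v = does (part v Fin.≟ i) ∧ does (side v Bool.≟ b)

  covered : Fin k → Bool → List (Edge n) → ℕ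
  covered i b F = countᵇ (inPart i b) (vertices F)

  Bipartite : List (Edge n) → Set
  Bipartite F = All (λ e → side (proj₁ e) ≢ side (proj₂ e)) F

  flow-edge : ∀ i u v → side u ≢ side v →
              flow (u , v) i ≡ + (𝟙 (inPart i true u) + 𝟙 (inPart i true v))
                             - + (𝟙 (inPart i false u) + 𝟙 (inPart i false v))
  flow-edge i u v u≁v with side u | side v
  ... | true  | true  = ⊥-elim (u≁v refl)
  ... | false | false = ⊥-elim (u≁v refl)
  ... | true  | false
    rewrite BoolP.∧-identityʳ (does (part u Fin.≟ i)) | BoolP.∧-zeroʳ (does (part v Fin.≟ i))
          | BoolP.∧-zeroʳ (does (part u Fin.≟ i)) | BoolP.∧-identityʳ (does (part v Fin.≟ i))
          | ℕP.+-identityʳ (𝟙 (does (part u Fin.≟ i)))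
    = refl
  ... | false | true
    rewrite BoolP.∧-identityʳ (does (part u Fin.≟ i)) | BoolP.∧-zeroʳ (does (part v Fin.≟ i))
          | BoolP.∧-zeroʳ (does (part u Fin.≟ i)) | BoolP.∧-identityʳ (does (part v Fin.≟ i))
          | ℕP.+-identityʳ (𝟙 (does (part u Fin.≟ i)))
    = refl

  netFlow≡covered : ∀ F → Bipartite F → ∀ i → netFlow F i ≡ + covered i true F - + covered i false F
  netFlow≡covered []            []           i = refl
  netFlow≡covered ((u , v) ∷ F) (u≁v ∷ F-bip) i
    rewrite flow-edge i u v u≁v | netFlow≡covered F F-bip i =
    regroup (+ 𝟙 (inPart i true u)) (+ 𝟙 (inPart i true v)) (+ covered i true F)
            (+ 𝟙 (inPart i false u)) (+ 𝟙 (inPart i false v)) (+ covered i false F)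
    where
    regroup : ∀ a b c a′ b′ c′ →
              ((a ℤ.+ b) - (a′ ℤ.+ b′)) ℤ.+ (c - c′) ≡ (a ℤ.+ (b ℤ.+ c)) - (a′ ℤ.+ (b′ ℤ.+ c′))
    regroup = solve-∀

  open Counting (Fin._≟_ {n})

  countOut+covered : ∀ F → Unique (vertices F) → ∀ i b →
                     countOut side part i b F + covered i b F ≡ count side part i b
  countOut+covered F F! i b =
    trans (cong (_+ covered i b F) (length-filter≡countᵇ _ (allFin n)))
          (trans (countᵇ-outside (inPart i b) (allFin⁺ n) ∈-allFin (vertices F) F!)
                 (sym (length-filter≡countᵇ _ (allFin n))))

  countOut-difference : ∀ F → Unique (vertices F) → Bipartite F → ∀ i →
    + countOut side part i true F - + countOut side part i false F
      ≡ (+ count side part i true - + count side part i false) - netFlow F i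
  countOut-difference F F! F-bip i = begin
    + out true - + out false
      ≡⟨ regroup (+ out true) (+ out false) (+ covered i true F) (+ covered i false F) ⟩
    (+ out true ℤ.+ + covered i true F) - (+ out false ℤ.+ + covered i false F)
      - (+ covered i true F - + covered i false F)
      ≡⟨ cong₂ _-_ (cong₂ _-_ (total true) (total false)) (sym (netFlow≡covered F F-bip i)) ⟩
    (+ count side part i true - + count side part i false) - netFlow F i ∎
    where
    open ≡-Reasoning
    out : Bool → ℕ
    out b = countOut side part i b F
    total : ∀ b → + out b ℤ.+ + covered i b F ≡ + count side part i b
    total b = trans (sym (ℤP.pos-+ (out b) (covered i b F))) (cong +_ (countOut+covered F F! i b))
    regroup : ∀ a a′ c c′ → a - a′ ≡ (a ℤ.+ c) - (a′ ℤ.+ c′) - (c - c′)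
    regroup = solve-∀

  balances⇔ : ∀ F → Unique (vertices F) → Bipartite F → ∀ i →
              Balances side part F i ⇔ netFlow F i ≡ + count side part i true - + count side part i false
  balances⇔ F F! F-bip i = mk⇔
    (λ bal → sym (ℤP.i-j≡0⇒i≡j _ _ (trans (sym difference) (ℤP.i≡j⇒i-j≡0 (cong +_ bal)))))
    (λ eq → ℤP.+-injective (ℤP.i-j≡0⇒i≡j _ _ (trans difference (ℤP.i≡j⇒i-j≡0 (sym eq)))))
    where
    difference : + countOut side part i true F - + countOut side part i false F
               ≡ (+ count side part i true - + count side part i false) - netFlow F i
    difference = countOut-difference F F! F-bip i

  ∑∣netFlow∣≡totalImb : ∀ F → Unique (vertices F) → Bipartite F → (∀ i → Balances side part F i) →
                        sum (tabulate (ℤ.∣_∣ ∘ netFlow F)) ≡ totalImb side part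
  ∑∣netFlow∣≡totalImb F F! F-bip F-bal =
    trans (cong sum (tabulate-cong ∣netFlow∣≡imb)) (sym (cong sum (map-tabulate id (imb side part))))
    where
    ∣netFlow∣≡imb : ∀ i → ℤ.∣ netFlow F i ∣ ≡ imb side part i
    ∣netFlow∣≡imb i =
      trans (cong ℤ.∣_∣ (trans (Equivalence.to (balances⇔ F F! F-bip i) (F-bal i)) (ℤP.m-n≡m⊖n Nₓ Nᵧ)))
            (∣m⊖n∣≡∣m-n∣ Nₓ Nᵧ)
      where
      Nₓ Nᵧ : ℕ
      Nₓ = count side part i true
      Nᵧ = count side part i false

proposition5p4 : (n k : ℕ) (side : Fin n → Bool) (E : Fin n → Fin n → Set)
    → IsBipartite side E
    → (part : Fin n → Fin k)
    → (M : List (Edge n))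
    → IsMatching E M
    → (∀ i → Balances side part M i)
    → Σ (List (Edge n)) (λ F →
    F ⊆ M
    × 2 * length F ≤ totalImb side part * k
    × (∀ i → Balances side part F i))
proposition5p4 n k side E bipartite part M (M-edges , M!) M-bal = F , F⊆M , bound , F-bal
  where
  open Orientation side part
  open AcyclicPart (acyclicPart M) renaming (arcs to F; arcs⊆M to F⊆M)
  M-bip : Bipartite M
  M-bip = All.map (λ {e} → bipartite (proj₁ e) (proj₂ e)) M-edges
  F-bip : Bipartite F
  F-bip = All-resp-⊆ F⊆M M-bip
  F! : Unique (vertices F)
  F! = Unique-resp-⊆ (vertices-⊆ F⊆M) M!
  F-bal : ∀ i → Balances side part F i
  F-bal i = Equivalence.from (balances⇔ F F! F-bip i)
              (trans (netFlow≗ i) (Equivalence.to (balances⇔ M M! M-bip i) (M-bal i)))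
  bound : 2 * length F ≤ totalImb side part * k
  bound = subst (2 * length F ≤_)
                (trans (cong (k *_) (∑∣netFlow∣≡totalImb F F! F-bip F-bal)) (ℕP.*-comm k _))
                (acyclic-length-bound F potential ascending)
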